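{- Let $\epsilon\in(0,\tfrac12)$ and let $\pi^*$ be a permutation of $[n]$ maximizing $\Psi$. Then there exist a subset $S\subseteq[n]$ and a permutation $\pi$ of $S$ such that $(S,\pi)$ is bulky and $\sum_{i\in S}\varphi_\pi(i)\ge\Psi_{\mathrm{heavy}}(\pi^*)$.
   Context: Instance: $n$ items with strictly positive weights $w_1,\dots,w_n$, $T$ periods with capacities $W_1\le\cdots\le W_T$, non-negative profits $p_{it}$. For a permutation $\pi$ of a set of items $S$, the completion time of $i\in S$ is $C_\pi(i)=\sum_{j\in S:\pi(j)\le\pi(i)}w_j$, its profit is $\varphi_\pi(i)=\max\{p_{it}:t\in[T+1],\ W_t\ge C_\pi(i)\}$ with $W_{T+1}=\infty$, $p_{i,T+1}=0$, and $\Psi(\pi)=\sum_{i\in S}\varphi_\pi(i)$. Let $K=\lceil\log_{1+\epsilon}(\sum_{i\in[n]}w_i)\rceil$, $\mathcal{I}_0=[0,1]$ and $\mathcal{I}_k=((1+\epsilon)^{k-1},(1+\epsilon)^k]$ for $k\in[K]$. Item $i$ is $k$-heavy if $w_i\ge\epsilon^2(1+\epsilon)^k$ and $k$-light otherwise; $H_k$ denotes the set of $k$-heavy items. For a permutation $\pi$ of $[n]$, $\Psi_{\mathrm{heavy}}(\pi)=\sum_{k=0}^{K}\sum_{i\in H_k:\,C_\pi(i)\in\mathcal{I}_k}\varphi_\pi(i)$. A pair $(S,\pi)$ with $S\subseteq[n]$ and $\pi$ a permutation of $S$ is bulky if for every $k\in\{0,\dots,K\}$, $\{i\in S: C_\pi(i)\in\mathcal{I}_k\}\subseteq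 H_k$.
   Formalization: The parameter ε, the weights $w_i$, the capacities $W_t$ and the profits $p_{it}$ are all rational numbers. -}

module Defs where

open import Data.Nat using (ℕ; zero; suc)
open import Data.Fin using (Fin)
open import Data.List using (List; []; _∷_; map; foldr; allFin)
open import Data.Product using (_×_; _,_)
open import Data.Bool using (if_then_else_)
open import Relation.Nullary using (Dec; does; yes; no; _×-dec_)
open import Data.Rational using (ℚ; 0ℚ; 1ℚ; _+_; _*_; _≤_; _<_; _⊔_)
open import Data.Rational.Properties using (_≤?_; _<?_)
open import Data.List.Membership.Propositional using (_∈_)

_^ℚ_ : ℚ → ℕ → ℚ
x ^ℚ zero = 1ℚ
x ^ℚ suc k = x * (x ^ℚ k)

sumℚ : List ℚ → ℚ
sumℚ = foldr _+_ 0ℚ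

total : ∀ {n} → (Fin n → ℚ) → ℚ
total {n} w = sumℚ (map w (allFin n))

-- phi(i) for completion time c:
-- max{ p_it : t in [T+1], W_t >= c }, with W_{T+1} = ∞, p_{i,T+1} = 0
profitAt : ∀ {n T} → (Fin T → ℚ) → (Fin n → Fin T → ℚ) → Fin n → ℚ → ℚ
profitAt {T = T} W p i c =
  foldr (λ t acc → if does (c ≤? W t) then p i t ⊔ acc else acc) 0ℚ (allFin T)

-- A sequence sigma (list of distinct items) represents a permutation of
-- the set S of its elements; pairs (i , C_sigma(i)).
completionsFrom : ∀ {n} → (Fin n → ℚ) → ℚ → List (Fin n) → List (Fin n × ℚ)
completionsFrom w acc [] = []
completionsFrom w acc (i ∷ σ) = (i , acc + w i) ∷ completionsFrom w (acc + w i) σ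

completions : ∀ {n} → (Fin n → ℚ) → List (Fin n) → List (Fin n × ℚ)
completions w σ = completionsFrom w 0ℚ σ

Ψ : ∀ {n T} → (Fin n → ℚ) → (Fin T → ℚ) → (Fin n → Fin T → ℚ) → List (Fin n) → ℚ
Ψ w W p σ = sumℚ (map (λ { (i , c) → profitAt W p i c }) (completions w σ))

InI : ℚ → ℕ → ℚ → Set
InI ε zero c = (0ℚ ≤ c) × (c ≤ 1ℚ)
InI ε (suc j) c = ((1ℚ + ε) ^ℚ j < c) × (c ≤ (1ℚ + ε) ^ℚ suc j)

InI? : ∀ ε k c → Dec (InI ε k c)
InI? ε zero c = (0ℚ ≤? c) ×-dec (c ≤? 1ℚ)
InI? ε (suc j) c = ((1ℚ + ε) ^ℚ j <? c) ×-dec (c ≤? (1ℚ + ε) ^ℚ suc j)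

Heavy : ∀ {n} → ℚ → (Fin n → ℚ) → ℕ → Fin n → Set
Heavy ε w k i = (ε * ε) * ((1ℚ + ε) ^ℚ k) ≤ w i

-- K is the least natural number with total <= (1+eps)^K, i.e.
-- K = max(0, ceil(log_{1+eps} total)).
IsK : ℚ → ℚ → ℕ → Set
IsK ε tot K = (tot ≤ (1ℚ + ε) ^ℚ K) × (∀ k → tot ≤ (1ℚ + ε) ^ℚ k → K Data.Nat.≤ k)

-- index k in {0,...,ceil(log_{1+eps} total)}, given k ≤ K:
-- only the index 0 can fall outside (when ceil(log) < 0, i.e. (1+eps)*total <= 1)
InRange : ℚ → ℚ → ℕ → Set
InRange ε tot k = (1ℚ + ε) ^ℚ k < (1ℚ + ε) * tot

InRange? : ∀ ε tot k → Dec (InRange ε tot k)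
InRange? ε tot k = ((1ℚ + ε) ^ℚ k) <? ((1ℚ + ε) * tot)

range : ℕ → List ℕ
range K = Data.List.upTo (suc K)

Ψheavy : ∀ {n T} → ℚ → ℕ → (Fin n → ℚ) → (Fin T → ℚ) → (Fin n → Fin T → ℚ) → List (Fin n) → ℚ
Ψheavy {n} ε K w W p π =
  sumℚ (map (λ k → sumℚ (map (λ { (i , c) →
      if does (InRange? ε (total w) k ×-dec (((ε * ε) * ((1ℚ + ε) ^ℚ k) ≤? w i) ×-dec InI? ε k c))
      then profitAt W p i c else 0ℚ }) (completions w π))) (range K))

Bulky : ∀ {n} → ℚ → ℕ → (Fin n → ℚ) → List (Fin n) → Set
Bulky ε K w σ = ∀ k → k Data.Nat.≤ K → InRange ε (total w) k →
  ∀ i c → (i , c) ∈ completions w σ → InI ε k c → Heavy ε w k i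

{-# OPTIONS --safe #-}
-- Keep from π* exactly the items that contribute to Ψheavy, in their original order.
-- Every kept item then completes no later than before, and profits only decrease with
-- completion time, so it earns at least its old profit; it is counted only once in
-- Ψheavy because the intervals I_k are disjoint. A kept item completing in I_k used to
-- complete in some I_k₀ with k ≤ k₀ where it was k₀-heavy, hence it is k-heavy, since the
-- heaviness threshold grows with k.
module Submission where

open import Defs
open import Data.Nat using (ℕ)
open import Data.Fin using (Fin)
open import Data.List using (List; allFin)
open import Data.Product using (Σ; _×_)
open import Data.Rational using (ℚ; 0ℚ; ½; _≤_; _<_)
open import Data.List.Relation.Unary.Unique.Propositional using (Unique)
open import Data.List.Relation.Binary.Permutation.Propositional using (_↭_)

open import Data.Nat as ℕ using (zero; suc; _≤′_; ≤′-refl; ≤′-step)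
import Data.Nat.Properties as ℕ
open import Data.List using ([]; _∷_; map; foldr; filter)
open import Data.List.Properties using (map-cong; filter-none)
open import Data.Product using (_,_; proj₁; proj₂)
open import Data.Bool using (if_then_else_)
open import Function using (const; _∘_)
open import Relation.Nullary using (Dec; does; yes; no; _×-dec_; contradiction)
open import Relation.Unary using (Pred; Decidable)
open import Relation.Binary.PropositionalEquality
open import Data.Rational using (1ℚ; _+_; _*_; _⊔_; nonNegative)
open import Data.Rational.Properties
open import Algebra.Bundles using (CommutativeMonoid)
open import Algebra.Properties.CommutativeSemigroup (CommutativeMonoid.commutativeSemigroup +-0-commutativeMonoid)
  using (interchange)
open import Data.List.Relation.Unary.All as All using (All; []; _∷_)
open import Data.List.Relation.Unary.All.Properties using (all-filter)
open import Data.List.Relation.Unary.Any as Any using (Any; any?)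
open import Data.List.Relation.Unary.AllPairs using ([]; _∷_)
open import Data.List.Relation.Binary.Pointwise using (Pointwise; []; _∷_)
open import Data.List.Relation.Binary.Sublist.Propositional using (_⊆_; []; _∷_; _∷ʳ_)
open import Data.List.Relation.Binary.Sublist.Propositional.Properties using (All-resp-⊆; filter-⊆)
import Data.List.Relation.Binary.Sublist.Propositional.Properties as Sublist
import Data.List.Relation.Binary.Permutation.Propositional as Perm
import Data.List.Relation.Binary.Permutation.Setoid.Properties as PermSetoid
import Data.List.Relation.Unary.Unique.Propositional.Properties as Unique

module _ {a} {A : Set a} where

  sum-zeros : ∀ (xs : List A) → sumℚ (map (const 0ℚ) xs) ≡ 0ℚ
  sum-zeros [] = refl
  sum-zeros (_ ∷ xs) = trans (+-identityˡ _) (sum-zeros xs)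

  sum-+ : ∀ (f g : A → ℚ) xs →
    sumℚ (map f xs) + sumℚ (map g xs) ≡ sumℚ (map (λ x → f x + g x) xs)
  sum-+ f g [] = +-identityˡ 0ℚ
  sum-+ f g (x ∷ xs) =
    trans (interchange (f x) _ (g x) _) (cong (f x + g x +_) (sum-+ f g xs))

  sum-mono-Pointwise : ∀ {b r} {B : Set b} {R : A → B → Set r} {f : A → ℚ} {g : B → ℚ} →
    (∀ {x y} → R x y → f x ≤ g y) →
    ∀ {xs ys} → Pointwise R xs ys → sumℚ (map f xs) ≤ sumℚ (map g ys)
  sum-mono-Pointwise f≤g [] = ≤-refl
  sum-mono-Pointwise f≤g (r ∷ rs) = +-mono-≤ (f≤g r) (sum-mono-Pointwise f≤g rs)

  module _ {p} {P : Pred A p} (P? : Decidable P) where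

    sum-if≡sum-filter : ∀ (f : A → ℚ) xs →
      sumℚ (map (λ x → if does (P? x) then f x else 0ℚ) xs) ≡ sumℚ (map f (filter P? xs))
    sum-if≡sum-filter f [] = refl
    sum-if≡sum-filter f (x ∷ xs) with P? x
    ... | yes _ = cong (f x +_) (sum-if≡sum-filter f xs)
    ... | no _ = trans (+-identityˡ _) (sum-if≡sum-filter f xs)

    sum-indicator : ∀ (q : ℚ) {xs} → Unique xs → (∀ {x y} → P x → P y → x ≡ y) →
      sumℚ (map (λ x → if does (P? x) then q else 0ℚ) xs) ≡ (if does (any? P? xs) then q else 0ℚ)
    sum-indicator q [] P-unique = refl
    sum-indicator q {x ∷ xs} (x∉xs ∷ xs-unique) P-unique with P? x
    ... | no _ = trans (+-identityˡ _) (sum-indicator q xs-unique P-unique)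
    ... | yes Px = begin
      q + sumℚ (map (λ y → if does (P? y) then q else 0ℚ) xs) ≡⟨ cong (q +_) rest≡0 ⟩
      q + 0ℚ                                                 ≡⟨ +-identityʳ q ⟩
      q                                                      ∎
      where
      open ≡-Reasoning
      rest≡0 : sumℚ (map (λ y → if does (P? y) then q else 0ℚ) xs) ≡ 0ℚ
      rest≡0 = begin
        _                                   ≡⟨ sum-if≡sum-filter (const q) xs ⟩
        sumℚ (map (const q) (filter P? xs)) ≡⟨ cong (sumℚ ∘ map (const q)) (filter-none P? none) ⟩
        0ℚ                                  ∎
        where none = All.map (λ x≢y Py → x≢y (P-unique Px Py)) x∉xs

module _ {a b} {A : Set a} {B : Set b} where

  sum-swap : ∀ (F : A → B → ℚ) xs ys →
    sumℚ (map (λ x → sumℚ (map (F x) ys)) xs) ≡ sumℚ (map (λ y → sumℚ (map (λ x → F x y) xs)) ys)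
  sum-swap F [] ys = sym (sum-zeros ys)
  sum-swap F (x ∷ xs) ys =
    trans (cong (sumℚ (map (F x) ys) +_) (sum-swap F xs ys)) (sum-+ (F x) _ ys)

  All-Pointwise : ∀ {p q r} {P : Pred A p} {Q : Pred B q} {R : A → B → Set r} →
    (∀ {x y} → R x y → P x → Q y) → ∀ {xs ys} → Pointwise R xs ys → All P xs → All Q ys
  All-Pointwise P⇒Q [] [] = []
  All-Pointwise P⇒Q (r ∷ rs) (px ∷ pxs) = P⇒Q r px ∷ All-Pointwise P⇒Q rs pxs

Unique-resp-⊇ : ∀ {a} {A : Set a} {xs ys : List A} → xs ⊆ ys → Unique ys → Unique xs
Unique-resp-⊇ [] [] = []
Unique-resp-⊇ (_ ∷ʳ xs⊆ys) (_ ∷ ys-unique) = Unique-resp-⊇ xs⊆ys ys-unique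
Unique-resp-⊇ (refl ∷ xs⊆ys) (y∉ys ∷ ys-unique) =
  All-resp-⊆ xs⊆ys y∉ys ∷ Unique-resp-⊇ xs⊆ys ys-unique

module _ {x : ℚ} (1≤x : 1ℚ ≤ x) where

  ^ℚ-nonNeg : ∀ k → 0ℚ ≤ x ^ℚ k
  ^ℚ-nonNeg zero = <⇒≤ (positive⁻¹ 1ℚ)
  ^ℚ-nonNeg (suc k) = begin
    0ℚ            ≡⟨ sym (*-zeroʳ x) ⟩
    x * 0ℚ        ≤⟨ *-monoˡ-≤-nonNeg x {{nonNegative (≤-trans (<⇒≤ (positive⁻¹ 1ℚ)) 1≤x)}} (^ℚ-nonNeg k) ⟩
    x * x ^ℚ k    ∎
    where open ≤-Reasoning

  ^ℚ-monoʳ-≤ : ∀ {k k'} → k ℕ.≤ k' → x ^ℚ k ≤ x ^ℚ k'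
  ^ℚ-monoʳ-≤ = go ∘ ℕ.≤⇒≤′
    where
    go : ∀ {k k'} → k ≤′ k' → x ^ℚ k ≤ x ^ℚ k'
    go ≤′-refl = ≤-refl
    go {k} {suc k'} (≤′-step k≤′k') = begin
      x ^ℚ k           ≤⟨ go k≤′k' ⟩
      x ^ℚ k'          ≡⟨ sym (*-identityˡ (x ^ℚ k')) ⟩
      1ℚ * x ^ℚ k'     ≤⟨ *-monoʳ-≤-nonNeg (x ^ℚ k') {{nonNegative (^ℚ-nonNeg k')}} 1≤x ⟩
      x * x ^ℚ k'      ∎
      where open ≤-Reasoning

module _ {ε : ℚ} (0≤ε : 0ℚ ≤ ε) where

  private
    1≤1+ε : 1ℚ ≤ 1ℚ + ε
    1≤1+ε = ≤-trans (≤-reflexive (sym (+-identityʳ 1ℚ))) (+-monoʳ-≤ 1ℚ 0≤ε)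

  InI-upper : ∀ k {c} → InI ε k c → c ≤ (1ℚ + ε) ^ℚ k
  InI-upper zero (_ , c≤1) = c≤1
  InI-upper (suc k) (_ , c≤) = c≤

  InI-index-mono : ∀ k k' {c c'} → InI ε k c → InI ε k' c' → c ≤ c' → k ℕ.≤ k'
  InI-index-mono zero k' _ _ _ = ℕ.z≤n
  InI-index-mono (suc k) k' (<c , _) c'∈I c≤c' with k' ℕ.≤? k
  ... | no k'≰k = ℕ.≰⇒> k'≰k
  ... | yes k'≤k = contradiction (begin-strict
    (1ℚ + ε) ^ℚ k       <⟨ <c ⟩
    _                   ≤⟨ c≤c' ⟩
    _                   ≤⟨ InI-upper k' c'∈I ⟩
    (1ℚ + ε) ^ℚ k'      ≤⟨ ^ℚ-monoʳ-≤ 1≤1+ε k'≤k ⟩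
    (1ℚ + ε) ^ℚ k       ∎) (<-irrefl refl)
    where open ≤-Reasoning

  Heavy-antitone : ∀ {n} (w : Fin n → ℚ) {k k' i} → k ℕ.≤ k' → Heavy ε w k' i → Heavy ε w k i
  Heavy-antitone w k≤k' = ≤-trans
    (*-monoˡ-≤-nonNeg (ε * ε) {{nonNeg*nonNeg⇒nonNeg ε {{ε≥0}} ε {{ε≥0}}}} (^ℚ-monoʳ-≤ 1≤1+ε k≤k'))
    where ε≥0 = nonNegative 0≤ε

profitAt-antitone : ∀ {n T} (W : Fin T → ℚ) (p : Fin n → Fin T → ℚ) i {c c'} →
  c ≤ c' → profitAt W p i c' ≤ profitAt W p i c
profitAt-antitone {T = T} W p i {c} {c'} c≤c' = go (allFin T)
  where
  profitOver : ℚ → List (Fin T) → ℚ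
  profitOver d = foldr (λ t acc → if does (d ≤? W t) then p i t ⊔ acc else acc) 0ℚ
  go : ∀ ts → profitOver c' ts ≤ profitOver c ts
  go [] = ≤-refl
  go (t ∷ ts) = step (c' ≤? W t) (c ≤? W t) (go ts)
    where
    step : ∀ {a a'} (c'≤?Wt : Dec (c' ≤ W t)) (c≤?Wt : Dec (c ≤ W t)) → a ≤ a' →
      (if does c'≤?Wt then p i t ⊔ a else a) ≤ (if does c≤?Wt then p i t ⊔ a' else a')
    step (yes _) (yes _) a≤a' = ⊔-monoʳ-≤ (p i t) a≤a'
    step (yes c'≤Wt) (no c≰Wt) _ = contradiction (≤-trans c≤c' c'≤Wt) c≰Wt
    step (no _) (yes _) a≤a' = ≤-trans a≤a' (p≤q⊔p (p i t) _)
    step (no _) (no _) a≤a' = a≤a'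

module Completions {n} (w : Fin n → ℚ) (w>0 : ∀ i → 0ℚ < w i) where

  _≽_ : Fin n × ℚ → Fin n × ℚ → Set
  (i , c) ≽ (j , c') = i ≡ j × c' ≤ c

  map-proj₁-completionsFrom : ∀ a l → map proj₁ (completionsFrom w a l) ≡ l
  map-proj₁-completionsFrom a [] = refl
  map-proj₁-completionsFrom a (i ∷ l) = cong (i ∷_) (map-proj₁-completionsFrom (a + w i) l)

  completions-filter-≽ : ∀ {p} {P : Pred (Fin n × ℚ) p} (P? : Decidable P) {a b} → a ≤ b → ∀ l →
    Pointwise _≽_ (filter P? (completionsFrom w b l))
                  (completionsFrom w a (map proj₁ (filter P? (completionsFrom w b l))))
  completions-filter-≽ P? a≤b [] = []
  completions-filter-≽ P? {a} {b} a≤b (i ∷ l) with P? (i , b + w i)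
  ... | yes _ = (refl , a+wi≤b+wi) ∷ completions-filter-≽ P? a+wi≤b+wi l
    where a+wi≤b+wi = +-monoˡ-≤ (w i) a≤b
  ... | no _ = completions-filter-≽ P? (≤-trans a≤b b≤b+wi) l
    where
    b≤b+wi : b ≤ b + w i
    b≤b+wi = ≤-trans (≤-reflexive (sym (+-identityʳ b))) (+-monoʳ-≤ b (<⇒≤ (w>0 i)))

module HeavySubschedule {n T} (ε : ℚ) (0≤ε : 0ℚ ≤ ε) (w : Fin n → ℚ) (w>0 : ∀ i → 0ℚ < w i)
  (W : Fin T → ℚ) (p : Fin n → Fin T → ℚ) (K : ℕ) where

  open Completions w w>0

  HeavyAt : ℕ → Pred (Fin n × ℚ) _
  HeavyAt k (i , c) = InRange ε (total w) k × Heavy ε w k i × InI ε k c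

  -- Spelled out so that it is literally the test inside Ψheavy.
  HeavyAt? : ∀ k → Decidable (HeavyAt k)
  HeavyAt? k (i , c) =
    InRange? ε (total w) k ×-dec (((ε * ε) * ((1ℚ + ε) ^ℚ k) ≤? w i) ×-dec InI? ε k c)

  HeavyAt-unique : ∀ {x k k'} → HeavyAt k x → HeavyAt k' x → k ≡ k'
  HeavyAt-unique {k = k} {k'} (_ , _ , c∈Iₖ) (_ , _ , c∈Iₖ') = ℕ.≤-antisym
    (InI-index-mono 0≤ε k k' c∈Iₖ c∈Iₖ' ≤-refl) (InI-index-mono 0≤ε k' k c∈Iₖ' c∈Iₖ ≤-refl)

  Contributes : Pred (Fin n × ℚ) _
  Contributes x = Any (λ k → HeavyAt k x) (range K)

  Contributes? : Decidable Contributes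
  Contributes? x = any? (λ k → HeavyAt? k x) (range K)

  Contributes⇒Heavy : ∀ {x y} → x ≽ y → Contributes x →
    ∀ k → InI ε k (proj₂ y) → Heavy ε w k (proj₁ y)
  Contributes⇒Heavy {i , c} {.i , c'} (refl , c'≤c) contributes k c'∈Iₖ
    with k₀ , (_ , heavy , c∈Iₖ₀) ← Any.satisfied contributes
    = Heavy-antitone 0≤ε w (InI-index-mono 0≤ε k k₀ c'∈Iₖ c∈Iₖ₀ c'≤c) heavy

  heavySubschedule : List (Fin n) → List (Fin n)
  heavySubschedule π = map proj₁ (filter Contributes? (completions w π))

  heavySubschedule-unique : ∀ {π} → Unique π → Unique (heavySubschedule π)
  heavySubschedule-unique {π} = Unique-resp-⊇
    (subst (heavySubschedule π ⊆_) (map-proj₁-completionsFrom 0ℚ π)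
      (Sublist.map⁺ proj₁ (filter-⊆ Contributes? (completions w π))))

  heavySubschedule-bulky : ∀ π → Bulky ε K w (heavySubschedule π)
  heavySubschedule-bulky π k _ _ i c ic∈ = All.lookup
    (All-Pointwise Contributes⇒Heavy (completions-filter-≽ Contributes? ≤-refl π)
      (all-filter Contributes? (completions w π)))
    ic∈ k

  Ψheavy≤Ψ-heavySubschedule : ∀ π → Ψheavy ε K w W p π ≤ Ψ w W p (heavySubschedule π)
  Ψheavy≤Ψ-heavySubschedule π = begin
    Ψheavy ε K w W p π
      ≡⟨ sum-swap _ (range K) cs ⟩
    sumℚ (map (λ x → sumℚ (map (λ k → if does (HeavyAt? k x) then φ x else 0ℚ) (range K))) cs)
      ≡⟨ cong sumℚ (map-cong (λ x → sum-indicator (λ k → HeavyAt? k x) (φ x)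
                                       (Unique.upTo⁺ (suc K)) HeavyAt-unique) cs) ⟩
    sumℚ (map (λ x → if does (Contributes? x) then φ x else 0ℚ) cs)
      ≡⟨ sum-if≡sum-filter Contributes? φ cs ⟩
    sumℚ (map φ (filter Contributes? cs))
      ≤⟨ sum-mono-Pointwise profit-≽ (completions-filter-≽ Contributes? ≤-refl π) ⟩
    Ψ w W p (heavySubschedule π) ∎
    where
    open ≤-Reasoning
    cs = completions w π
    φ : Fin n × ℚ → ℚ
    φ (i , c) = profitAt W p i c
    profit-≽ : ∀ {x y} → x ≽ y → φ x ≤ φ y
    profit-≽ {i , c} {.i , c'} (refl , c'≤c) = profitAt-antitone W p i c'≤c

lemma2 : ∀ {n T : ℕ} (ε : ℚ) → 0ℚ < ε → ε < ½
  → (w : Fin n → ℚ) → (∀ i → 0ℚ < w i)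
  → (W : Fin T → ℚ) → (∀ s t → s Data.Fin.≤ t → W s ≤ W t)
  → (p : Fin n → Fin T → ℚ) → (∀ i t → 0ℚ ≤ p i t)
  → (K : ℕ) → IsK ε (total w) K
  → (πs : List (Fin n)) → πs ↭ allFin n
  → (∀ σ → σ ↭ allFin n → Ψ w W p σ ≤ Ψ w W p πs)
  → Σ (List (Fin n)) (λ σ →
      Unique σ × Bulky ε K w σ × Ψheavy ε K w W p πs ≤ Ψ w W p σ)
lemma2 {n} ε 0<ε _ w w>0 W _ p _ K _ πs πs↭allFin _ =
  heavySubschedule πs ,
  heavySubschedule-unique πs-unique ,
  heavySubschedule-bulky πs ,
  Ψheavy≤Ψ-heavySubschedule πs
  where
  open HeavySubschedule ε (<⇒≤ 0<ε) w w>0 W p K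
  πs-unique : Unique πs
  πs-unique = PermSetoid.Unique-resp-↭ (setoid (Fin n)) (Perm.↭⇒↭ₛ (Perm.↭-sym πs↭allFin))
    (Unique.allFin⁺ n)
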